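{- There is an absolute constant $\gamma_0>0$ such that the following holds. Let $X$ be a set of cardinality $n$, $m\in\{1,\dots,n\}$, $l\in\{m+1,\dots,n\}$, $\gamma$ with $\gamma_0\le\gamma\le\min\{\frac{l}{m^2},\binom{n}{l}\}$, and let $\mathcal{F}\subset\binom{X}{m}$ weighted by $w:\mathcal{F}\to\mathbb{R}_{\ge0}$ satisfy the $\Gamma_w\!\left(\frac{14\gamma mn}{l}\right)$-condition. Then \[ \|\mathcal{D}\| < \frac{e^{ -2\kappa(\mathcal{F})}}{1-(2\gamma)^{ -1}}\binom{n}{l}\binom{l}{m}^2 . \]
   Context: $\binom{X}{m}$ is the family of $m$-subsets of $X$. Size: $\|\mathcal{G}\|=\sum_{U\in\mathcal{G}\cap\mathcal{F}}w(U)$ for $\mathcal{G}\subset\binom{X}{m}$. Sparsity: $\kappa(\mathcal{F}) = \ln\binom{n}{m} - \ln\|\mathcal{F}\|$. $\Gamma_w(b)$-condition ($b>1$): $\|\mathcal{F}\|>0$ and $\sum_{U,V\in\mathcal{F},|U\cap V|=j}w(U)w(V)\le\|\mathcal{F}\|^2\binom{m}{j}b^{ -j}$ for all $j\in\{1,\dots,m\}$. Here $\|\mathcal{D}\| = \sum_{U,V\in\mathcal{F}}\sum_{Y\in\binom{X}{l},\,U\cup V\subset Y} w(U)w(V) = \sum_{Y\in\binom{X}{l}}\left\|\binom{Y}{m}\right\|^2$. -}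

module Defs where

open import Level using (0ℓ)
open import Data.Bool using (Bool; true; false; if_then_else_; _∧_; _∨_; not)
open import Data.Nat as ℕ using (ℕ; zero; suc; _≡ᵇ_)
open import Data.Nat.Combinatorics using (_C_)
open import Data.List using (List; []; _∷_; map; _++_; foldr)
open import Data.Vec using (Vec; []; _∷_)
open import Data.Fin.Subset using (Subset; _∩_; ∣_∣)
open import Data.Product using (Σ; ∃; _×_; _,_)
open import Data.Sum using (_⊎_)
open import Relation.Binary.PropositionalEquality using (_≡_; _≢_)
open import Relation.Binary.Definitions using (Trichotomous; Transitive)
open import Algebra.Structures using (IsCommutativeRing)

-- A model of the real numbers: a complete ordered field (with ≡ as equality).
-- The inverse is total; only x * x ⁻¹ ≡ 1 for x ≢ 0 is postulated.
record RealField : Set₁ where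
  infixl 6 _+_
  infixl 7 _*_
  infix 4 _<_ _≤_
  field
    R : Set
    0# 1# : R
    _+_ _*_ : R → R → R
    -_ : R → R
    _⁻¹ : R → R
    _<_ : R → R → Set
    isCommutativeRing : IsCommutativeRing _≡_ _+_ _*_ -_ 0# 1#
    0≢1 : 0# ≢ 1#
    ⁻¹-inverse : ∀ x → x ≢ 0# → x * (x ⁻¹) ≡ 1#
    <-trans : Transitive _<_
    <-tri : Trichotomous _≡_ _<_
    +-mono-< : ∀ {x y} z → x < y → x + z < y + z
    *-pos : ∀ {x y} → 0# < x → 0# < y → 0# < x * y

  _≤_ : R → R → Set
  x ≤ y = x < y ⊎ x ≡ y

  _-_ : R → R → R
  x - y = x + (- y)

  field
    complete : (P : R → Set) → ∃ P → (∃ λ u → ∀ x → P x → x ≤ u) →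
      ∃ λ s → (∀ x → P x → x ≤ s) × (∀ u → (∀ x → P x → x ≤ u) → s ≤ u)

  fromℕ : ℕ → R
  fromℕ zero = 0#
  fromℕ (suc k) = 1# + fromℕ k

  _^_ : R → ℕ → R
  x ^ zero = 1#
  x ^ suc k = x * (x ^ k)

  sumR : List R → R
  sumR = foldr _+_ 0#

allSubsets : (n : ℕ) → List (Subset n)
allSubsets zero = [] ∷ []
allSubsets (suc n) = map (false ∷_) (allSubsets n) ++ map (true ∷_) (allSubsets n)

isSub : ∀ {n} → Subset n → Subset n → Bool
isSub [] [] = true
isSub (a ∷ u) (b ∷ v) = (not a ∨ b) ∧ isSub u v

module Over (K : RealField) where
  open RealField K

  -- A weighted family: F ⊆ subsets of X = Fin n given by a membership test,
  -- weight w (only its values on F matter).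
  -- weight of U counted in sums over F: w U if U ∈ F, else 0
  wt : ∀ {n} → (Subset n → Bool) → (Subset n → R) → Subset n → R
  wt inF w U = if inF U then w U else 0#

  normF : (n m : ℕ) → (Subset n → Bool) → (Subset n → R) → R
  normF n m inF w =
    sumR (map (λ U → if ∣ U ∣ ≡ᵇ m then wt inF w U else 0#) (allSubsets n))

  normBinomY : (n m : ℕ) → (Subset n → Bool) → (Subset n → R) → Subset n → R
  normBinomY n m inF w Y =
    sumR (map (λ U → if (∣ U ∣ ≡ᵇ m) ∧ isSub U Y then wt inF w U else 0#) (allSubsets n))

  normD : (n m l : ℕ) → (Subset n → Bool) → (Subset n → R) → R
  normD n m l inF w =
    sumR (map (λ Y → if ∣ Y ∣ ≡ᵇ l
                      then normBinomY n m inF w Y * normBinomY n m inF w Y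
                      else 0#) (allSubsets n))

  pairSum : (n : ℕ) → (Subset n → Bool) → (Subset n → R) → ℕ → R
  pairSum n inF w j =
    sumR (map (λ U → sumR (map (λ V →
      if ∣ U ∩ V ∣ ≡ᵇ j then wt inF w U * wt inF w V else 0#) (allSubsets n)))
      (allSubsets n))

  Gamma : (n m : ℕ) → (Subset n → Bool) → (Subset n → R) → R → Set
  Gamma n m inF w b =
    (1# < b) × (0# < normF n m inF w) ×
    (∀ j → 1 ℕ.≤ j → j ℕ.≤ m →
       pairSum n inF w j ≤
         (normF n m inF w * normF n m inF w) * fromℕ (m C j) * ((b ^ j) ⁻¹))

module Submission where

open import Defs
open import Data.Bool using (Bool; true)
open import Data.Nat as ℕ using (ℕ)
open import Data.Nat.Combinatorics using (_C_)
open import Data.Fin.Subset using (Subset; ∣_∣)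
open import Data.Product using (Σ; _×_; _,_)
open import Relation.Binary.PropositionalEquality using (_≡_)

-- Expanding the square, ‖D‖ = Σ_{U,V ∈ F} w(U) w(V) · #{Y : |Y| = l, U ∪ V ⊆ Y}, and when
-- |U ∩ V| = j that count is N_j = C(n − 2m + j, l − 2m + j).  Grouping the pairs by j gives
-- ‖D‖ = Σ_{j ≤ m} P_j N_j, where P_j is the pair sum controlled by the Γ_w(b)-condition:
-- P_0 ≤ ‖F‖² and P_j ≤ ‖F‖² C(m,j) b^{-j}.  As N_{j+1}/N_j ≤ 2n/l and C(m,j) ≤ m^j, we get
-- C(m,j) N_j ≤ N_0 (2mn/l)^j ≤ N_0 ((2γ)^{-1} b)^j, hence ‖D‖ ≤ ‖F‖² N_0 Σ_j (2γ)^{-j}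
-- < ‖F‖² N_0 / (1 − (2γ)^{-1}), and N_0 C(n,m)² ≤ C(n,l) C(l,m)² finishes the proof.
-- The choice γ₀ = 4 forces l ≥ 4m² ≥ 4m, which the ratio bound 2n/l needs.

module Binomial where

  open import Data.Nat
  open import Data.Nat.Properties
  open import Data.Nat.Combinatorics
  open import Data.Nat.Tactic.RingSolver using (solve-∀)
  open import Relation.Binary.PropositionalEquality

  [1+n]C[1+k]*[1+k]≡nCk*[1+n] : ∀ n k → (suc n C suc k) * suc k ≡ (n C k) * suc n
  [1+n]C[1+k]*[1+k]≡nCk*[1+n] zero zero = refl
  [1+n]C[1+k]*[1+k]≡nCk*[1+n] zero (suc k)
    rewrite k>n⇒nCk≡0 {1} {2 + k} (s≤s (s≤s z≤n)) | k>n⇒nCk≡0 {0} {suc k} (s≤s z≤n) = refl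
  [1+n]C[1+k]*[1+k]≡nCk*[1+n] (suc n) zero =
    trans (*-identityʳ ((2 + n) C 1)) (trans (nC1≡n (2 + n)) (sym (*-identityˡ (2 + n))))
  [1+n]C[1+k]*[1+k]≡nCk*[1+n] (suc n) (suc k) = begin
    ((2 + n) C (2 + k)) * (2 + k)
      ≡⟨ cong (_* (2 + k)) (nCk+nC[k+1]≡[n+1]C[k+1] (suc n) (suc k)) ⟨
    (a + b) * (2 + k)
      ≡⟨ expand a b (suc k) ⟩
    a * (1 + k) + a + b * (2 + k)
      ≡⟨ cong₂ (λ x y → x + a + y) ([1+n]C[1+k]*[1+k]≡nCk*[1+n] n k) ([1+n]C[1+k]*[1+k]≡nCk*[1+n] n (suc k)) ⟩
    (n C k) * (1 + n) + a + (n C (1 + k)) * (1 + n)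
      ≡⟨ collect (n C k) (n C (1 + k)) (suc n) a ⟩
    ((n C k) + (n C (1 + k))) * (1 + n) + a
      ≡⟨ cong (λ x → x * (1 + n) + a) (nCk+nC[k+1]≡[n+1]C[k+1] n k) ⟩
    a * (1 + n) + a
      ≡⟨ +-comm (a * (1 + n)) a ⟩
    a + a * (1 + n)
      ≡⟨ *-suc a (suc n) ⟨
    a * (2 + n) ∎
    where
    open ≡-Reasoning
    a b : ℕ
    a = suc n C suc k
    b = suc n C suc (suc k)
    expand : ∀ a b k → (a + b) * suc k ≡ a * k + a + b * suc k
    expand = solve-∀
    collect : ∀ x y z a → x * z + a + y * z ≡ (x + y) * z + a
    collect = solve-∀

  [m+n]Cm≡[m+n]Cn : ∀ m n → (m + n) C m ≡ (m + n) C n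
  [m+n]Cm≡[m+n]Cn m n = trans (nCk≡nC[n∸k] (m≤m+n m n)) (cong ((m + n) C_) (m+n∸m≡n m n))

  [1+m+n]Cm*[1+n]≡[m+n]Cm*[1+m+n] : ∀ m n → (suc (m + n) C m) * suc n ≡ ((m + n) C m) * suc (m + n)
  [1+m+n]Cm*[1+n]≡[m+n]Cm*[1+m+n] m n = begin
    (suc (m + n) C m) * suc n      ≡⟨ cong (λ x → (x C m) * suc n) (+-suc m n) ⟨
    ((m + suc n) C m) * suc n      ≡⟨ cong (_* suc n) ([m+n]Cm≡[m+n]Cn m (suc n)) ⟩
    ((m + suc n) C suc n) * suc n  ≡⟨ cong (λ x → (x C suc n) * suc n) (trans (+-suc m n) (cong suc (+-comm m n))) ⟩
    (suc (n + m) C suc n) * suc n  ≡⟨ [1+n]C[1+k]*[1+k]≡nCk*[1+n] (n + m) n ⟩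
    ((n + m) C n) * suc (n + m)    ≡⟨ cong (λ x → (x C n) * suc x) (+-comm n m) ⟩
    ((m + n) C n) * suc (m + n)    ≡⟨ cong (_* suc (m + n)) ([m+n]Cm≡[m+n]Cn m n) ⟨
    ((m + n) C m) * suc (m + n)    ∎
    where open ≡-Reasoning

  k≤n⇒0<nCk : ∀ {n k} → k ≤ n → 0 < n C k
  k≤n⇒0<nCk {n} {zero} _ = s≤s z≤n
  k≤n⇒0<nCk {suc n} {suc k} (s≤s k≤n) =
    subst (0 <_) (nCk+nC[k+1]≡[n+1]C[k+1] n k) (<-≤-trans (k≤n⇒0<nCk k≤n) (m≤m+n (n C k) (n C suc k)))

  nCk≤n^k : ∀ n k → n C k ≤ n ^ k
  nCk≤n^k n zero = ≤-refl
  nCk≤n^k zero (suc k) = ≤-reflexive (k>n⇒nCk≡0 {0} {suc k} (s≤s z≤n))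
  nCk≤n^k (suc n) (suc k) = begin
    suc n C suc k              ≡⟨ nCk+nC[k+1]≡[n+1]C[k+1] n k ⟨
    n C k + n C suc k          ≤⟨ +-mono-≤ (nCk≤n^k n k) (nCk≤n^k n (suc k)) ⟩
    n ^ k + n * n ^ k          ≤⟨ +-mono-≤ (^-monoˡ-≤ k (n≤1+n n)) (*-monoʳ-≤ n (^-monoˡ-≤ k (n≤1+n n))) ⟩
    suc n ^ k + n * suc n ^ k  ∎
    where open ≤-Reasoning

  private
    ratio-step : ∀ {N N′ A A′ K K′ B x y : ℕ} s t →
      N′ * suc s ≡ N * x → A′ * suc t ≡ A * y → K′ * suc s ≡ K * y → x * y ≤ suc t * suc t →
      N * (A * A) ≤ K * (B * B) → N′ * (A′ * A′) ≤ K′ * (B * B)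
    ratio-step {N} {N′} {A} {A′} {K} {K′} {B} {x} {y} s t eN eA eK xy≤t² NA²≤KB² =
      *-cancelˡ-≤ (suc s * (suc t * suc t)) (begin
        suc s * (suc t * suc t) * (N′ * (A′ * A′))  ≡⟨ regroup₁ (suc s) (suc t) N′ A′ ⟩
        (N′ * suc s) * (A′ * suc t) * (A′ * suc t)  ≡⟨ cong₂ (λ u v → u * v * v) eN eA ⟩
        (N * x) * (A * y) * (A * y)                 ≡⟨ regroup₂ N x A y ⟩
        N * (A * A) * (x * y * y)                   ≤⟨ *-mono-≤ NA²≤KB² (*-monoˡ-≤ y xy≤t²) ⟩
        K * (B * B) * (suc t * suc t * y)           ≡⟨ regroup₃ K B (suc t) y ⟩
        (K * y) * (B * B) * (suc t * suc t)         ≡⟨ cong (λ u → u * (B * B) * (suc t * suc t)) eK ⟨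
        (K′ * suc s) * (B * B) * (suc t * suc t)    ≡⟨ regroup₄ K′ (suc s) B (suc t) ⟩
        suc s * (suc t * suc t) * (K′ * (B * B))    ∎)
      where
      open ≤-Reasoning
      regroup₁ : ∀ s t n a → s * (t * t) * (n * (a * a)) ≡ (n * s) * (a * t) * (a * t)
      regroup₁ = solve-∀
      regroup₂ : ∀ n x a y → (n * x) * (a * y) * (a * y) ≡ n * (a * a) * (x * y * y)
      regroup₂ = solve-∀
      regroup₃ : ∀ k b t y → k * (b * b) * (t * t * y) ≡ (k * y) * (b * b) * (t * t)
      regroup₃ = solve-∀
      regroup₄ : ∀ k s b t → (k * s) * (b * b) * (t * t) ≡ s * (t * t) * (k * (b * b))
      regroup₄ = solve-∀

  -- Induction on d: going from d to d + 1 multiplies the left side by (p+d+1)/(d+1) · ((n+1)/(n+1−m))²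
  -- and the right side by (n+1)/(d+1), and (p+d+1)(n+1) = (n+1−m)² − m² is a difference of squares.
  [p+d]Cp*[nCm]²≤nCl*[lCm]² : ∀ m p d → let l = m + m + p ; n = l + d in
    ((p + d) C p) * ((n C m) * (n C m)) ≤ (n C l) * ((l C m) * (l C m))
  [p+d]Cp*[nCm]²≤nCl*[lCm]² m p zero
    rewrite +-identityʳ p | +-identityʳ (m + m + p) | nCn≡1 p | nCn≡1 (m + m + p) = ≤-refl
  [p+d]Cp*[nCm]²≤nCl*[lCm]² m p (suc d) =
    ratio-step {(p + d) C p} {(p + suc d) C p} {(l + d) C m} {(l + suc d) C m} {(l + d) C l} {(l + suc d) C l}
      {l C m} {suc (p + d)} {suc (l + d)} d q eN eA eK xy≤q² ([p+d]Cp*[nCm]²≤nCl*[lCm]² m p d)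
    where
    l q : ℕ
    l = m + m + p
    q = m + p + d
    l+d≡m+q : l + d ≡ m + q
    l+d≡m+q = regroup m p d
      where regroup : ∀ m p d → m + m + p + d ≡ m + (m + p + d)
            regroup = solve-∀
    eN : ((p + suc d) C p) * suc d ≡ ((p + d) C p) * suc (p + d)
    eN = trans (cong (λ z → (z C p) * suc d) (+-suc p d)) ([1+m+n]Cm*[1+n]≡[m+n]Cm*[1+m+n] p d)
    eA : ((l + suc d) C m) * suc q ≡ ((l + d) C m) * suc (l + d)
    eA = begin
      ((l + suc d) C m) * suc q    ≡⟨ cong (λ z → (z C m) * suc q) (trans (+-suc l d) (cong suc l+d≡m+q)) ⟩
      (suc (m + q) C m) * suc q    ≡⟨ [1+m+n]Cm*[1+n]≡[m+n]Cm*[1+m+n] m q ⟩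
      ((m + q) C m) * suc (m + q)  ≡⟨ cong (λ z → (z C m) * suc z) l+d≡m+q ⟨
      ((l + d) C m) * suc (l + d)  ∎
      where open ≡-Reasoning
    eK : ((l + suc d) C l) * suc d ≡ ((l + d) C l) * suc (l + d)
    eK = trans (cong (λ z → (z C l) * suc d) (+-suc l d)) ([1+m+n]Cm*[1+n]≡[m+n]Cm*[1+m+n] l d)
    xy≤q² : suc (p + d) * suc (l + d) ≤ suc q * suc q
    xy≤q² = ≤-trans (m≤m+n _ (m * m)) (≤-reflexive (difference-of-squares m p d))
      where difference-of-squares : ∀ m p d → suc (p + d) * suc (m + m + p + d) + m * m ≡ suc (m + p + d) * suc (m + p + d)
            difference-of-squares = solve-∀

  private
    l[s+d]≤2[l+d]s : ∀ {l} s d → l ≤ 2 * s → l * (s + d) ≤ 2 * (l + d) * s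
    l[s+d]≤2[l+d]s {l} s d l≤2s = begin
      l * (s + d)                ≡⟨ *-distribˡ-+ l s d ⟩
      l * s + l * d              ≤⟨ +-monoʳ-≤ (l * s) (*-monoˡ-≤ d l≤2s) ⟩
      l * s + 2 * s * d          ≤⟨ m≤m+n (l * s + 2 * s * d) (l * s) ⟩
      l * s + 2 * s * d + l * s  ≡⟨ regroup l s d ⟩
      2 * (l + d) * s            ∎
      where
      open ≤-Reasoning
      regroup : ∀ l s d → l * s + 2 * s * d + l * s ≡ 2 * (l + d) * s
      regroup = solve-∀

  [a+j+d]C[a+j]*l^j≤[a+d]Ca*[2[l+d]]^j : ∀ a d l j → l ≤ 2 * suc a →
    ((a + j + d) C (a + j)) * l ^ j ≤ ((a + d) C a) * (2 * (l + d)) ^ j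
  [a+j+d]C[a+j]*l^j≤[a+d]Ca*[2[l+d]]^j a d l zero _ rewrite +-identityʳ a = ≤-refl
  [a+j+d]C[a+j]*l^j≤[a+d]Ca*[2[l+d]]^j a d l (suc j) l≤2[1+a] = *-cancelʳ-≤ _ _ s (begin
    X′ * (l * l ^ j) * s        ≡⟨ regroup₁ X′ l (l ^ j) s ⟩
    (X′ * s) * l * l ^ j        ≡⟨ cong (λ z → z * l * l ^ j) absorb ⟩
    X * (s + d) * l * l ^ j     ≡⟨ regroup₂ X (s + d) l (l ^ j) ⟩
    (X * l ^ j) * (l * (s + d)) ≤⟨ *-mono-≤ ([a+j+d]C[a+j]*l^j≤[a+d]Ca*[2[l+d]]^j a d l j l≤2[1+a]) (l[s+d]≤2[l+d]s s d l≤2s) ⟩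
    (X₀ * M ^ j) * (M * s)      ≡⟨ regroup₃ X₀ (M ^ j) M s ⟩
    X₀ * (M * M ^ j) * s        ∎)
    where
    open ≤-Reasoning
    s M X X′ X₀ : ℕ
    s = suc (a + j)
    M = 2 * (l + d)
    X = (a + j + d) C (a + j)
    X′ = (a + suc j + d) C (a + suc j)
    X₀ = (a + d) C a
    absorb : X′ * s ≡ X * (s + d)
    absorb = trans (cong (λ z → ((z + d) C z) * s) (+-suc a j)) ([1+n]C[1+k]*[1+k]≡nCk*[1+n] (a + j + d) (a + j))
    l≤2s : l ≤ 2 * s
    l≤2s = ≤-trans l≤2[1+a] (*-monoʳ-≤ 2 (s≤s (m≤m+n a j)))
    regroup₁ : ∀ x l t s → x * (l * t) * s ≡ (x * s) * l * t
    regroup₁ = solve-∀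
    regroup₂ : ∀ x u l t → x * u * l * t ≡ (x * t) * (l * u)
    regroup₂ = solve-∀
    regroup₃ : ∀ x t m s → (x * t) * (m * s) ≡ x * (m * t) * s
    regroup₃ = solve-∀

module Supersets where

  open import Function using (_∘_)
  open import Data.Bool using (false; if_then_else_; _∧_; T)
  open import Data.Bool.Properties using (∧-zeroʳ)
  open import Data.Empty using (⊥-elim)
  open import Data.Nat
  open import Data.Nat.Properties
  open import Data.Nat.Combinatorics
  open import Data.Nat.ListAction using (sum)
  open import Data.Nat.ListAction.Properties using (sum-++)
  open import Data.Nat.Tactic.RingSolver using (solve-∀)
  open import Data.List using (List; []; _∷_; _++_; map)
  open import Data.List.Properties using (map-++; map-∘)
  open import Data.Vec using ([]; _∷_)
  open import Data.Fin.Subset using (_∪_; _∩_)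
  open import Data.Fin.Subset.Properties using (∣p∣≤n)
  open import Relation.Binary.PropositionalEquality

  sum-allSubsets-suc : ∀ n (f : Subset (suc n) → ℕ) → sum (map f (allSubsets (suc n)))
    ≡ sum (map (f ∘ (false ∷_)) (allSubsets n)) + sum (map (f ∘ (true ∷_)) (allSubsets n))
  sum-allSubsets-suc n f = begin
    sum (map f (xs ++ ys))           ≡⟨ cong sum (map-++ f xs ys) ⟩
    sum (map f xs ++ map f ys)       ≡⟨ sum-++ (map f xs) (map f ys) ⟩
    sum (map f xs) + sum (map f ys)  ≡⟨ cong₂ _+_ (cong sum (map-∘ (allSubsets n))) (cong sum (map-∘ (allSubsets n))) ⟨
    sum (map (f ∘ (false ∷_)) (allSubsets n)) + sum (map (f ∘ (true ∷_)) (allSubsets n)) ∎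
    where
    open ≡-Reasoning
    xs ys : List (Subset (suc n))
    xs = map (false ∷_) (allSubsets n)
    ys = map (true ∷_) (allSubsets n)

  sum-map-zero : ∀ {A : Set} {f : A → ℕ} xs → (∀ x → f x ≡ 0) → sum (map f xs) ≡ 0
  sum-map-zero [] _ = refl
  sum-map-zero (x ∷ xs) f≡0 = cong₂ _+_ (f≡0 x) (sum-map-zero xs f≡0)

  isSub⇒∣p∣≤∣q∣ : ∀ {n} (p q : Subset n) → isSub p q ≡ true → ∣ p ∣ ≤ ∣ q ∣
  isSub⇒∣p∣≤∣q∣ [] [] _ = z≤n
  isSub⇒∣p∣≤∣q∣ (false ∷ p) (false ∷ q) p⊆q = isSub⇒∣p∣≤∣q∣ p q p⊆q
  isSub⇒∣p∣≤∣q∣ (false ∷ p) (true ∷ q) p⊆q = m≤n⇒m≤1+n (isSub⇒∣p∣≤∣q∣ p q p⊆q)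
  isSub⇒∣p∣≤∣q∣ (true ∷ p) (true ∷ q) p⊆q = s≤s (isSub⇒∣p∣≤∣q∣ p q p⊆q)

  isSub-∪ : ∀ {n} (p q r : Subset n) → isSub (p ∪ q) r ≡ isSub p r ∧ isSub q r
  isSub-∪ [] [] [] = refl
  isSub-∪ (x ∷ p) (y ∷ q) (z ∷ r) rewrite isSub-∪ p q r with x | y | z
  ... | false | false | _     = refl
  ... | false | true  | false = sym (∧-zeroʳ (isSub p r))
  ... | false | true  | true  = refl
  ... | true  | _     | false = refl
  ... | true  | false | true  = refl
  ... | true  | true  | true  = refl

  ∣p∪q∣+∣p∩q∣≡∣p∣+∣q∣ : ∀ {n} (p q : Subset n) → ∣ p ∪ q ∣ + ∣ p ∩ q ∣ ≡ ∣ p ∣ + ∣ q ∣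
  ∣p∪q∣+∣p∩q∣≡∣p∣+∣q∣ [] [] = refl
  ∣p∪q∣+∣p∩q∣≡∣p∣+∣q∣ (false ∷ p) (false ∷ q) = ∣p∪q∣+∣p∩q∣≡∣p∣+∣q∣ p q
  ∣p∪q∣+∣p∩q∣≡∣p∣+∣q∣ (false ∷ p) (true ∷ q) =
    trans (cong suc (∣p∪q∣+∣p∩q∣≡∣p∣+∣q∣ p q)) (sym (+-suc ∣ p ∣ ∣ q ∣))
  ∣p∪q∣+∣p∩q∣≡∣p∣+∣q∣ (true ∷ p) (false ∷ q) = cong suc (∣p∪q∣+∣p∩q∣≡∣p∣+∣q∣ p q)
  ∣p∪q∣+∣p∩q∣≡∣p∣+∣q∣ (true ∷ p) (true ∷ q) = cong suc (begin
    ∣ p ∪ q ∣ + suc ∣ p ∩ q ∣  ≡⟨ +-suc ∣ p ∪ q ∣ ∣ p ∩ q ∣ ⟩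
    suc (∣ p ∪ q ∣ + ∣ p ∩ q ∣) ≡⟨ cong suc (∣p∪q∣+∣p∩q∣≡∣p∣+∣q∣ p q) ⟩
    suc (∣ p ∣ + ∣ q ∣)         ≡⟨ +-suc ∣ p ∣ ∣ q ∣ ⟨
    ∣ p ∣ + suc ∣ q ∣           ∎)
    where open ≡-Reasoning

  supersetCount : ∀ {n} → ℕ → Subset n → ℕ
  supersetCount {n} l Z = sum (map (λ Y → if isSub Z Y ∧ (∣ Y ∣ ≡ᵇ l) then 1 else 0) (allSubsets n))

  supersetCount-∣Z∣+t : ∀ {n} (Z : Subset n) t → supersetCount (∣ Z ∣ + t) Z ≡ (n ∸ ∣ Z ∣) C t
  supersetCount-∣Z∣+t [] zero = refl
  supersetCount-∣Z∣+t [] (suc t) = refl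
  supersetCount-∣Z∣+t {suc n} (false ∷ Z) zero = begin
    supersetCount (∣ Z ∣ + 0) (false ∷ Z)
      ≡⟨ sum-allSubsets-suc n _ ⟩
    supersetCount (∣ Z ∣ + 0) Z + sum (map (λ Y → if isSub Z Y ∧ (suc ∣ Y ∣ ≡ᵇ ∣ Z ∣ + 0) then 1 else 0) (allSubsets n))
      ≡⟨ cong₂ _+_ (supersetCount-∣Z∣+t Z 0) (sum-map-zero (allSubsets n) too-small) ⟩
    1 + 0 ∎
    where
    open ≡-Reasoning
    too-small : ∀ Y → (if isSub Z Y ∧ (suc ∣ Y ∣ ≡ᵇ ∣ Z ∣ + 0) then 1 else 0) ≡ 0
    too-small Y with isSub Z Y in Z⊆Y | suc ∣ Y ∣ ≡ᵇ ∣ Z ∣ + 0 in ∣Y∣<∣Z∣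
    ... | false | _ = refl
    ... | true | false = refl
    ... | true | true = ⊥-elim (<⇒≱ (≤-reflexive (trans (≡ᵇ⇒≡ _ _ (subst T (sym ∣Y∣<∣Z∣) _)) (+-identityʳ ∣ Z ∣)))
                                     (isSub⇒∣p∣≤∣q∣ Z Y Z⊆Y))
  supersetCount-∣Z∣+t {suc n} (false ∷ Z) (suc t) = begin
    supersetCount (∣ Z ∣ + suc t) (false ∷ Z)
      ≡⟨ sum-allSubsets-suc n _ ⟩
    supersetCount (∣ Z ∣ + suc t) Z + sum (map (λ Y → if isSub Z Y ∧ (suc ∣ Y ∣ ≡ᵇ ∣ Z ∣ + suc t) then 1 else 0) (allSubsets n))
     
       ≡⟨ cong (λ u → supersetCount (∣ Z ∣ + suc t) Z + sum (map (λ Y → if isSub Z Y ∧ (suc ∣ Y ∣ ≡ᵇ u) then 1 else 0) (allSubsets n))) (+-suc ∣ Z ∣ t) ⟩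
    supersetCount (∣ Z ∣ + suc t) Z + supersetCount (∣ Z ∣ + t) Z
      ≡⟨ cong₂ _+_ (supersetCount-∣Z∣+t Z (suc t)) (supersetCount-∣Z∣+t Z t) ⟩
    ((n ∸ ∣ Z ∣) C suc t) + ((n ∸ ∣ Z ∣) C t)
      ≡⟨ +-comm ((n ∸ ∣ Z ∣) C suc t) ((n ∸ ∣ Z ∣) C t) ⟩
    ((n ∸ ∣ Z ∣) C t) + ((n ∸ ∣ Z ∣) C suc t)
      ≡⟨ nCk+nC[k+1]≡[n+1]C[k+1] (n ∸ ∣ Z ∣) t ⟩
    (suc (n ∸ ∣ Z ∣) C suc t)
      ≡⟨ cong (_C suc t) (+-∸-assoc 1 (∣p∣≤n Z)) ⟨
    ((suc n ∸ ∣ Z ∣) C suc t) ∎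
    where open ≡-Reasoning
  supersetCount-∣Z∣+t {suc n} (true ∷ Z) t = trans (sum-allSubsets-suc n _)
    (cong₂ _+_ (sum-map-zero (allSubsets n) (λ _ → refl)) (supersetCount-∣Z∣+t Z t))

  supersetCount-∪ : ∀ {m p d} (U V : Subset (m + m + p + d)) → ∣ U ∣ ≡ m → ∣ V ∣ ≡ m →
    supersetCount (m + m + p) (U ∪ V) ≡ (p + ∣ U ∩ V ∣ + d) C (p + ∣ U ∩ V ∣)
  supersetCount-∪ {m} {p} {d} U V ∣U∣≡m ∣V∣≡m = begin
    supersetCount (m + m + p) (U ∪ V)    ≡⟨ cong (λ l → supersetCount l (U ∪ V)) l≡u+[p+k] ⟩
    supersetCount (u + (p + k)) (U ∪ V)  ≡⟨ supersetCount-∣Z∣+t (U ∪ V) (p + k) ⟩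
    ((m + m + p + d ∸ u) C (p + k))      ≡⟨ cong (λ n → (n ∸ u) C (p + k)) n≡u+[p+k+d] ⟩
    ((u + (p + k + d) ∸ u) C (p + k))    ≡⟨ cong (_C (p + k)) (m+n∸m≡n u (p + k + d)) ⟩
    ((p + k + d) C (p + k))              ∎
    where
    open ≡-Reasoning
    u k : ℕ
    u = ∣ U ∪ V ∣
    k = ∣ U ∩ V ∣
    l≡u+[p+k] : m + m + p ≡ u + (p + k)
    l≡u+[p+k] = begin
      m + m + p        ≡⟨ cong (_+ p) (trans (∣p∪q∣+∣p∩q∣≡∣p∣+∣q∣ U V) (cong₂ _+_ ∣U∣≡m ∣V∣≡m)) ⟨
      u + k + p        ≡⟨ regroup u k p ⟩
      u + (p + k)      ∎
      where regroup : ∀ u k p → u + k + p ≡ u + (p + k)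
            regroup = solve-∀
    n≡u+[p+k+d] : m + m + p + d ≡ u + (p + k + d)
    n≡u+[p+k+d] = trans (cong (_+ d) l≡u+[p+k]) (+-assoc u (p + k) d)

module OrderedFieldProperties (K : RealField) where

  open RealField K
  open import Function using (_∘_; id)
  open import Data.Bool using (if_then_else_)
  open import Data.Nat as ℕ using (zero; suc)
  import Data.Nat.Properties as ℕ
  open import Data.Nat.ListAction using (sum)
  open import Data.Sum using (inj₁; inj₂)
  open import Data.Empty using (⊥-elim)
  open import Data.List using (List; []; _∷_; map; upTo)
  open import Data.List.Properties using (map-∘; map-cong; map-applyUpTo)
  open import Data.List.Membership.Propositional using (_∈_)
  open import Data.List.Relation.Unary.Any using (here; there)
  open import Relation.Nullary using (¬_)
  open import Relation.Binary.PropositionalEquality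
  open import Relation.Binary.Bundles using (StrictPartialOrder)
  open import Relation.Binary.Consequences using (tri⇒irr; tri⇒asym)
  open import Relation.Binary.Definitions using (tri<; tri≈; tri>)
  open import Algebra.Bundles using (CommutativeRing)
  import Algebra.Solver.CommutativeMonoid as CommutativeMonoidSolver
  import Algebra.Properties.CommutativeSemigroup as CommutativeSemigroupProperties
  import Relation.Binary.Reasoning.StrictPartialOrder as StrictPartialOrderReasoning

  commutativeRing : CommutativeRing _ _
  commutativeRing = record { isCommutativeRing = isCommutativeRing }

  open CommutativeRing commutativeRing public
    using (+-comm; +-assoc; +-identityˡ; +-identityʳ; *-comm; *-assoc; *-identityˡ; *-identityʳ;
           distribˡ; distribʳ; zeroˡ; zeroʳ; -‿inverseˡ; -‿inverseʳ)
  open CommutativeRing commutativeRing using (ring; +-commutativeSemigroup; *-commutativeSemigroup; *-commutativeMonoid)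
  open import Algebra.Properties.Ring ring using (-‿distribˡ-*; -‿involutive)
  open CommutativeSemigroupProperties +-commutativeSemigroup using () renaming (interchange to +-interchange)
  open CommutativeSemigroupProperties *-commutativeSemigroup using () renaming (interchange to *-interchange)

  module *-Solver = CommutativeMonoidSolver *-commutativeMonoid

  strictPartialOrder : StrictPartialOrder _ _ _
  strictPartialOrder = record { isStrictPartialOrder = record
    { isEquivalence = isEquivalence ; irrefl = tri⇒irr <-tri ; trans = <-trans ; <-resp-≈ = resp₂ _<_ } }

  module ≤-Reasoning = StrictPartialOrderReasoning strictPartialOrder
  open ≤-Reasoning

  open import Relation.Binary.Properties.StrictPartialOrder strictPartialOrder public
    using () renaming (refl to ≤-refl; trans to ≤-trans; reflexive to ≤-reflexive)

  <-irrefl : ∀ {x} → ¬ x < x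
  <-irrefl = tri⇒irr <-tri refl

  <-asym : ∀ {x y} → x < y → ¬ y < x
  <-asym = tri⇒asym <-tri

  <-≤-trans : ∀ {x y z} → x < y → y ≤ z → x < z
  <-≤-trans {x} {y} {z} x<y y≤z = begin-strict x <⟨ x<y ⟩ y ≤⟨ y≤z ⟩ z ∎

  0<y-x⇒x<y : ∀ {x y} → 0# < y - x → x < y
  0<y-x⇒x<y {x} {y} 0<y-x = subst₂ _<_ (+-identityˡ x) y-x+x≡y (+-mono-< x 0<y-x)
    where
    y-x+x≡y : y - x + x ≡ y
    y-x+x≡y = trans (+-assoc y (- x) x) (trans (cong (y +_) (-‿inverseˡ x)) (+-identityʳ y))

  x<y⇒0<y-x : ∀ {x y} → x < y → 0# < y - x
  x<y⇒0<y-x {x} {y} x<y = subst (_< y - x) (-‿inverseʳ x) (+-mono-< (- x) x<y)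

  +-monoˡ-< : ∀ z {x y} → x < y → z + x < z + y
  +-monoˡ-< z {x} {y} x<y = subst₂ _<_ (+-comm x z) (+-comm y z) (+-mono-< z x<y)

  +-monoˡ-≤ : ∀ z {x y} → x ≤ y → z + x ≤ z + y
  +-monoˡ-≤ z (inj₁ x<y) = inj₁ (+-monoˡ-< z x<y)
  +-monoˡ-≤ z (inj₂ refl) = ≤-refl

  +-mono-≤ : ∀ {x y u v} → x ≤ y → u ≤ v → x + u ≤ y + v
  +-mono-≤ {x} {y} {u} {v} x≤y u≤v = begin
    x + u ≤⟨ +-monoˡ-≤ x u≤v ⟩
    x + v ≡⟨ +-comm x v ⟩
    v + x ≤⟨ +-monoˡ-≤ v x≤y ⟩
    v + y ≡⟨ +-comm v y ⟩
    y + v ∎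

  *-monoʳ-< : ∀ {z} → 0# < z → ∀ {x y} → x < y → x * z < y * z
  *-monoʳ-< {z} 0<z {x} {y} x<y = 0<y-x⇒x<y (subst (0# <_) [y-x]z≡yz-xz (*-pos (x<y⇒0<y-x x<y) 0<z))
    where
    [y-x]z≡yz-xz : (y - x) * z ≡ (y * z) - (x * z)
    [y-x]z≡yz-xz = trans (distribʳ z y (- x)) (cong (y * z +_) (sym (-‿distribˡ-* x z)))

  *-monoˡ-< : ∀ {z} → 0# < z → ∀ {x y} → x < y → z * x < z * y
  *-monoˡ-< {z} 0<z {x} {y} x<y = subst₂ _<_ (*-comm x z) (*-comm y z) (*-monoʳ-< 0<z x<y)

  *-monoʳ-≤ : ∀ {z} → 0# ≤ z → ∀ {x y} → x ≤ y → x * z ≤ y * z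
  *-monoʳ-≤ (inj₁ 0<z) (inj₁ x<y) = inj₁ (*-monoʳ-< 0<z x<y)
  *-monoʳ-≤ (inj₂ refl) {x} {y} (inj₁ _) = ≤-reflexive (trans (zeroʳ x) (sym (zeroʳ y)))
  *-monoʳ-≤ _ (inj₂ refl) = ≤-refl

  *-monoˡ-≤ : ∀ {z} → 0# ≤ z → ∀ {x y} → x ≤ y → z * x ≤ z * y
  *-monoˡ-≤ {z} 0≤z {x} {y} x≤y = subst₂ _≤_ (*-comm x z) (*-comm y z) (*-monoʳ-≤ 0≤z x≤y)

  *-nonneg : ∀ {x y} → 0# ≤ x → 0# ≤ y → 0# ≤ x * y
  *-nonneg {x} {y} 0≤x 0≤y = subst (_≤ x * y) (zeroˡ y) (*-monoʳ-≤ 0≤y 0≤x)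

  *-mono-≤ : ∀ {x y u v} → 0# ≤ x → 0# ≤ u → x ≤ y → u ≤ v → x * u ≤ y * v
  *-mono-≤ {x} {y} {u} {v} 0≤x 0≤u x≤y u≤v = begin
    x * u ≤⟨ *-monoʳ-≤ 0≤u x≤y ⟩
    y * u ≤⟨ *-monoˡ-≤ (≤-trans 0≤x x≤y) u≤v ⟩
    y * v ∎

  *-cancelʳ-≤ : ∀ {z} → 0# < z → ∀ {x y} → x * z ≤ y * z → x ≤ y
  *-cancelʳ-≤ 0<z {x} {y} xz≤yz with <-tri x y
  ... | tri< x<y _ _ = inj₁ x<y
  ... | tri≈ _ x≡y _ = inj₂ x≡y
  ... | tri> _ _ y<x = ⊥-elim (<-irrefl (<-≤-trans (*-monoʳ-< 0<z y<x) xz≤yz))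

  *-cancelʳ-< : ∀ {z} → 0# < z → ∀ {x y} → x * z < y * z → x < y
  *-cancelʳ-< 0<z {x} {y} xz<yz with <-tri x y
  ... | tri< x<y _ _ = x<y
  ... | tri≈ _ refl _ = ⊥-elim (<-irrefl xz<yz)
  ... | tri> _ _ y<x = ⊥-elim (<-asym xz<yz (*-monoʳ-< 0<z y<x))

  0<1 : 0# < 1#
  0<1 with <-tri 0# 1#
  ... | tri< 0<1 _ _ = 0<1
  ... | tri≈ _ 0≡1 _ = ⊥-elim (0≢1 0≡1)
  ... | tri> _ _ 1<0 = ⊥-elim (<-asym 1<0 (subst (0# <_) -1*-1≡1 (*-pos 0<-1 0<-1)))
    where
    0<-1 : 0# < - 1#
    0<-1 = subst₂ _<_ (-‿inverseʳ 1#) (+-identityˡ (- 1#)) (+-mono-< (- 1#) 1<0)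
    -1*-1≡1 : - 1# * - 1# ≡ 1#
    -1*-1≡1 = begin-equality
      - 1# * - 1#   ≡⟨ -‿distribˡ-* 1# (- 1#) ⟨
      - (1# * - 1#) ≡⟨ cong -_ (*-identityˡ (- 1#)) ⟩
      - (- 1#)      ≡⟨ -‿involutive 1# ⟩
      1#            ∎

  x*x⁻¹≡1 : ∀ {x} → 0# < x → x * x ⁻¹ ≡ 1#
  x*x⁻¹≡1 0<x = ⁻¹-inverse _ (λ x≡0 → <-irrefl (subst (0# <_) x≡0 0<x))

  x⁻¹*x≡1 : ∀ {x} → 0# < x → x ⁻¹ * x ≡ 1#
  x⁻¹*x≡1 {x} 0<x = trans (*-comm (x ⁻¹) x) (x*x⁻¹≡1 0<x)

  0<x⇒0<x⁻¹ : ∀ {x} → 0# < x → 0# < x ⁻¹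
  0<x⇒0<x⁻¹ {x} 0<x with <-tri 0# (x ⁻¹)
  ... | tri< 0<x⁻¹ _ _ = 0<x⁻¹
  ... | tri≈ _ 0≡x⁻¹ _ = ⊥-elim (0≢1 (trans (sym (zeroʳ x)) (trans (cong (x *_) 0≡x⁻¹) (x*x⁻¹≡1 0<x))))
  ... | tri> _ _ x⁻¹<0 = ⊥-elim (<-asym 0<1 (subst₂ _<_ (x*x⁻¹≡1 0<x) (zeroʳ x) (*-monoˡ-< 0<x x⁻¹<0)))

  x*z≤y⇒x≤y*z⁻¹ : ∀ {x y z} → 0# < z → x * z ≤ y → x ≤ y * z ⁻¹
  x*z≤y⇒x≤y*z⁻¹ {x} {y} {z} 0<z xz≤y = *-cancelʳ-≤ 0<z (begin
    x * z              ≤⟨ xz≤y ⟩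
    y                  ≡⟨ *-identityʳ y ⟨
    y * 1#             ≡⟨ cong (y *_) (x⁻¹*x≡1 0<z) ⟨
    y * (z ⁻¹ * z)     ≡⟨ *-assoc y (z ⁻¹) z ⟨
    y * z ⁻¹ * z       ∎)

  fromℕ-+ : ∀ a b → fromℕ (a ℕ.+ b) ≡ fromℕ a + fromℕ b
  fromℕ-+ zero b = sym (+-identityˡ (fromℕ b))
  fromℕ-+ (suc a) b = trans (cong (1# +_) (fromℕ-+ a b)) (sym (+-assoc 1# (fromℕ a) (fromℕ b)))

  fromℕ-* : ∀ a b → fromℕ (a ℕ.* b) ≡ fromℕ a * fromℕ b
  fromℕ-* zero b = sym (zeroˡ (fromℕ b))
  fromℕ-* (suc a) b = begin-equality
    fromℕ (b ℕ.+ a ℕ.* b)           ≡⟨ fromℕ-+ b (a ℕ.* b) ⟩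
    fromℕ b + fromℕ (a ℕ.* b)       ≡⟨ cong₂ _+_ (sym (*-identityˡ (fromℕ b))) (fromℕ-* a b) ⟩
    1# * fromℕ b + fromℕ a * fromℕ b ≡⟨ distribʳ (fromℕ b) 1# (fromℕ a) ⟨
    (1# + fromℕ a) * fromℕ b        ∎

  fromℕ-^ : ∀ a j → fromℕ (a ℕ.^ j) ≡ fromℕ a ^ j
  fromℕ-^ a zero = +-identityʳ 1#
  fromℕ-^ a (suc j) = trans (fromℕ-* a (a ℕ.^ j)) (cong (fromℕ a *_) (fromℕ-^ a j))

  fromℕ<fromℕ[1+n] : ∀ a → fromℕ a < fromℕ (suc a)
  fromℕ<fromℕ[1+n] a = subst (_< 1# + fromℕ a) (+-identityˡ (fromℕ a)) (+-mono-< (fromℕ a) 0<1)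

  0≤fromℕ : ∀ a → 0# ≤ fromℕ a
  0≤fromℕ zero = ≤-refl
  0≤fromℕ (suc a) = ≤-trans (0≤fromℕ a) (inj₁ (fromℕ<fromℕ[1+n] a))

  fromℕ-mono-≤ : ∀ {a b} → a ℕ.≤ b → fromℕ a ≤ fromℕ b
  fromℕ-mono-≤ {b = b} ℕ.z≤n = 0≤fromℕ b
  fromℕ-mono-≤ (ℕ.s≤s a≤b) = +-monoˡ-≤ 1# (fromℕ-mono-≤ a≤b)

  fromℕ-mono-< : ∀ {a b} → a ℕ.< b → fromℕ a < fromℕ b
  fromℕ-mono-< {a} a<b = <-≤-trans (fromℕ<fromℕ[1+n] a) (fromℕ-mono-≤ a<b)

  0<fromℕ : ∀ {a} → 0 ℕ.< a → 0# < fromℕ a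
  0<fromℕ = fromℕ-mono-<

  fromℕ-cancel-≤ : ∀ {a b} → fromℕ a ≤ fromℕ b → a ℕ.≤ b
  fromℕ-cancel-≤ {a} {b} fa≤fb with ℕ.≤-<-connex a b
  ... | inj₁ a≤b = a≤b
  ... | inj₂ b<a = ⊥-elim (<-irrefl (<-≤-trans (fromℕ-mono-< b<a) fa≤fb))

  ^-distribʳ-* : ∀ x y j → (x * y) ^ j ≡ x ^ j * y ^ j
  ^-distribʳ-* x y zero = sym (*-identityˡ 1#)
  ^-distribʳ-* x y (suc j) = trans (cong ((x * y) *_) (^-distribʳ-* x y j))
    (*-interchange x y (x ^ j) (y ^ j))

  0<x⇒0<x^j : ∀ {x} j → 0# < x → 0# < x ^ j
  0<x⇒0<x^j zero _ = 0<1
  0<x⇒0<x^j (suc j) 0<x = *-pos 0<x (0<x⇒0<x^j j 0<x)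

  0≤x⇒0≤x^j : ∀ {x} j → 0# ≤ x → 0# ≤ x ^ j
  0≤x⇒0≤x^j zero _ = inj₁ 0<1
  0≤x⇒0≤x^j (suc j) 0≤x = *-nonneg 0≤x (0≤x⇒0≤x^j j 0≤x)

  ^-monoˡ-≤ : ∀ j {x y} → 0# ≤ x → x ≤ y → x ^ j ≤ y ^ j
  ^-monoˡ-≤ zero _ _ = ≤-refl
  ^-monoˡ-≤ (suc j) 0≤x x≤y = *-mono-≤ 0≤x (0≤x⇒0≤x^j j 0≤x) x≤y (^-monoˡ-≤ j 0≤x x≤y)

  module _ {A : Set} where

    sumR-zero : ∀ (xs : List A) → sumR (map (λ _ → 0#) xs) ≡ 0#
    sumR-zero [] = refl
    sumR-zero (x ∷ xs) = trans (+-identityˡ _) (sumR-zero xs)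

    sumR-mono : ∀ {f g : A → R} xs → (∀ {x} → x ∈ xs → f x ≤ g x) → sumR (map f xs) ≤ sumR (map g xs)
    sumR-mono [] _ = ≤-refl
    sumR-mono (x ∷ xs) f≤g = +-mono-≤ (f≤g (here refl)) (sumR-mono xs (f≤g ∘ there))

    sumR-map-+ : ∀ (f g : A → R) xs → sumR (map (λ x → f x + g x) xs) ≡ sumR (map f xs) + sumR (map g xs)
    sumR-map-+ f g [] = sym (+-identityˡ 0#)
    sumR-map-+ f g (x ∷ xs) = trans (cong (f x + g x +_) (sumR-map-+ f g xs))
      (+-interchange (f x) (g x) _ _)

    *-distribˡ-sumR : ∀ c (f : A → R) xs → c * sumR (map f xs) ≡ sumR (map (λ x → c * f x) xs)
    *-distribˡ-sumR c f [] = zeroʳ c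
    *-distribˡ-sumR c f (x ∷ xs) = trans (distribˡ c (f x) _) (cong (c * f x +_) (*-distribˡ-sumR c f xs))

    *-distribʳ-sumR : ∀ c (f : A → R) xs → sumR (map f xs) * c ≡ sumR (map (λ x → f x * c) xs)
    *-distribʳ-sumR c f [] = zeroˡ c
    *-distribʳ-sumR c f (x ∷ xs) = trans (distribʳ c (f x) _) (cong (f x * c +_) (*-distribʳ-sumR c f xs))

  sumR-swap : ∀ {A B : Set} (f : A → B → R) xs ys →
    sumR (map (λ x → sumR (map (f x) ys)) xs) ≡ sumR (map (λ y → sumR (map (λ x → f x y) xs)) ys)
  sumR-swap f [] ys = sym (sumR-zero ys)
  sumR-swap f (x ∷ xs) ys = trans (cong (sumR (map (f x) ys) +_) (sumR-swap f xs ys))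
    (sym (sumR-map-+ (f x) (λ y → sumR (map (λ x → f x y) xs)) ys))

  sumR-*-sumR : ∀ {A B : Set} (f : A → R) (g : B → R) xs ys →
    sumR (map f xs) * sumR (map g ys) ≡ sumR (map (λ x → sumR (map (λ y → f x * g y) ys)) xs)
  sumR-*-sumR f g xs ys = trans (*-distribʳ-sumR (sumR (map g ys)) f xs)
    (cong sumR (map-cong (λ x → *-distribˡ-sumR (f x) g ys) xs))

  fromℕ-sum : ∀ {A : Set} (f : A → ℕ) xs → fromℕ (sum (map f xs)) ≡ sumR (map (fromℕ ∘ f) xs)
  fromℕ-sum f [] = refl
  fromℕ-sum f (x ∷ xs) = trans (fromℕ-+ (f x) _) (cong (fromℕ (f x) +_) (fromℕ-sum f xs))

  sumR-upTo-suc : ∀ (f : ℕ → R) K → sumR (map f (upTo (suc K))) ≡ f 0 + sumR (map (f ∘ suc) (upTo K))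
  sumR-upTo-suc f K = cong (λ js → f 0 + sumR js)
    (trans (cong (map f) (sym (map-applyUpTo id suc K))) (sym (map-∘ (upTo K))))

  sumR-δ : ∀ {K} k (f : ℕ → R) → k ℕ.< K → sumR (map (λ j → if k ℕ.≡ᵇ j then f j else 0#) (upTo K)) ≡ f k
  sumR-δ {suc K} zero f _ = trans (sumR-upTo-suc _ K) (trans (cong (f 0 +_) (sumR-zero (upTo K))) (+-identityʳ (f 0)))
  sumR-δ {suc K} (suc k) f (ℕ.s≤s k<K) =
    trans (sumR-upTo-suc _ K) (trans (+-identityˡ _) (sumR-δ k (f ∘ suc) k<K))

  geometric-sum : ∀ r K → sumR (map (r ^_) (upTo K)) * (1# - r) + r ^ K ≡ 1#
  geometric-sum r zero = trans (cong (_+ 1#) (zeroˡ (1# - r))) (+-identityˡ 1#)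
  geometric-sum r (suc K) = begin-equality
    G′ * s + r * r ^ K                  ≡⟨ cong (λ g → g * s + r * r ^ K) G′≡1+rG ⟩
    (1# + r * G) * s + r * r ^ K        ≡⟨ cong (_+ r * r ^ K) (distribʳ s 1# (r * G)) ⟩
    1# * s + r * G * s + r * r ^ K      ≡⟨ +-assoc (1# * s) (r * G * s) (r * r ^ K) ⟩
    1# * s + (r * G * s + r * r ^ K)    ≡⟨ cong₂ _+_ (*-identityˡ s) (cong (_+ r * r ^ K) (*-assoc r G s)) ⟩
    s + (r * (G * s) + r * r ^ K)       ≡⟨ cong (s +_) (distribˡ r (G * s) (r ^ K)) ⟨
    s + r * (G * s + r ^ K)             ≡⟨ cong (λ v → s + r * v) (geometric-sum r K) ⟩
    s + r * 1#                          ≡⟨ cong (s +_) (*-identityʳ r) ⟩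
    s + r                               ≡⟨ trans (+-assoc 1# (- r) r) (trans (cong (1# +_) (-‿inverseˡ r)) (+-identityʳ 1#)) ⟩
    1#                                  ∎
    where
    G G′ s : R
    G = sumR (map (r ^_) (upTo K))
    G′ = sumR (map (r ^_) (upTo (suc K)))
    s = 1# - r
    G′≡1+rG : G′ ≡ 1# + r * G
    G′≡1+rG = trans (sumR-upTo-suc (r ^_) K) (cong (1# +_) (sym (*-distribˡ-sumR r (r ^_) (upTo K))))

  geometric-sum< : ∀ {r} K → 0# < r → r < 1# → sumR (map (r ^_) (upTo K)) < (1# - r) ⁻¹
  geometric-sum< {r} K 0<r r<1 = *-cancelʳ-< 0<1-r (begin-strict
    G * (1# - r)            ≡⟨ +-identityʳ _ ⟨
    G * (1# - r) + 0#       <⟨ +-monoˡ-< (G * (1# - r)) (0<x⇒0<x^j K 0<r) ⟩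
    G * (1# - r) + r ^ K    ≡⟨ geometric-sum r K ⟩
    1#                      ≡⟨ x⁻¹*x≡1 0<1-r ⟨
    (1# - r) ⁻¹ * (1# - r)  ∎)
    where
    G : R
    G = sumR (map (r ^_) (upTo K))
    0<1-r : 0# < 1# - r
    0<1-r = x<y⇒0<y-x r<1

module WeightedFamilies (K : RealField) where

  open import Function using (_∘_)
  open import Function.Bundles using (Equivalence)
  open import Data.Bool using (false; if_then_else_; _∧_)
  open import Data.Bool.Properties using (if-eta; ∧-identityʳ; T-≡)
  open import Data.Nat using (zero; suc; _≡ᵇ_)
  import Data.Nat.Properties as ℕ
  open import Data.Nat.Tactic.RingSolver using (solve-∀)
  open import Data.Product using (proj₁; proj₂)
  open import Data.Sum using (inj₁)
  open import Data.List using (List; map; upTo)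
  open import Data.List.Properties using (map-cong)
  open import Data.List.Membership.Propositional using (_∈_)
  open import Data.List.Membership.Propositional.Properties using (∈-upTo⁻)
  open import Data.Fin.Subset using (_∪_; _∩_)
  open import Data.Fin.Subset.Properties using (∣p∩q∣≤∣p∣)
  open import Relation.Binary.PropositionalEquality
  open Binomial
  open Supersets using (supersetCount; isSub-∪; supersetCount-∪)
  open RealField K
  open Over K
  open OrderedFieldProperties K
  open ≤-Reasoning

  module Family {n : ℕ} (m : ℕ) (inF : Subset n → Bool) (w : Subset n → R)
    (∣U∣≡m : ∀ U → inF U ≡ true → ∣ U ∣ ≡ m) (0≤w : ∀ U → inF U ≡ true → 0# ≤ w U) where

    S : List (Subset n)
    S = allSubsets n

    W : Subset n → R
    W = wt inF w

    0≤W : ∀ U → 0# ≤ W U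
    0≤W U with inF U in U∈F
    ... | true = 0≤w U U∈F
    ... | false = ≤-refl

    W-restrict : ∀ U b → (if (∣ U ∣ ≡ᵇ m) ∧ b then W U else 0#) ≡ (if b then W U else 0#)
    W-restrict U b with inF U in U∈F
    ... | true rewrite ∣U∣≡m U U∈F | Equivalence.to T-≡ (ℕ.≡⇒≡ᵇ m m refl) = refl
    ... | false = trans (if-eta _) (sym (if-eta b))

    normF≡ΣW : normF n m inF w ≡ sumR (map W S)
    normF≡ΣW = cong sumR (map-cong (λ U → trans (cong (λ b → if b then W U else 0#) (sym (∧-identityʳ (∣ U ∣ ≡ᵇ m)))) (W-restrict U true)) S)

    W⊆ : Subset n → Subset n → R
    W⊆ Y U = if isSub U Y then W U else 0#

    normD≡ΣΣ : ∀ l → normD n m l inF w ≡ sumR (map (λ U → sumR (map (λ V → W U * W V * fromℕ (supersetCount l (U ∪ V))) S)) S)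
    normD≡ΣΣ l = begin-equality
      normD n m l inF w
        ≡⟨ cong sumR (map-cong square-as-pairs S) ⟩
      sumR (map (λ Y → sumR (map (λ U → sumR (map (term Y U) S)) S)) S)
        ≡⟨ sumR-swap (λ Y U → sumR (map (term Y U) S)) S S ⟩
      sumR (map (λ U → sumR (map (λ Y → sumR (map (term Y U) S)) S)) S)
        ≡⟨ cong sumR (map-cong (λ U → sumR-swap (λ Y → term Y U) S S) S) ⟩
      sumR (map (λ U → sumR (map (λ V → sumR (map (λ Y → term Y U V) S)) S)) S)
        ≡⟨ cong sumR (map-cong (λ U → cong sumR (map-cong (count-supersets U) S)) S) ⟩
      sumR (map (λ U → sumR (map (λ V → W U * W V * fromℕ (supersetCount l (U ∪ V))) S)) S) ∎
      where
      term : Subset n → Subset n → Subset n → R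
      term Y U V = if ∣ Y ∣ ≡ᵇ l then W⊆ Y U * W⊆ Y V else 0#

      square-as-pairs : ∀ Y → (if ∣ Y ∣ ≡ᵇ l then normBinomY n m inF w Y * normBinomY n m inF w Y else 0#)
                             ≡ sumR (map (λ U → sumR (map (term Y U) S)) S)
      square-as-pairs Y with ∣ Y ∣ ≡ᵇ l
      ... | true = trans (cong₂ _*_ normBinomY≡ normBinomY≡) (sumR-*-sumR (W⊆ Y) (W⊆ Y) S S)
        where
        normBinomY≡ : normBinomY n m inF w Y ≡ sumR (map (W⊆ Y) S)
        normBinomY≡ = cong sumR (map-cong (λ U → W-restrict U (isSub U Y)) S)
      ... | false = sym (trans (cong sumR (map-cong (λ _ → sumR-zero S) S)) (sumR-zero S))

      term≡ : ∀ U V Y → term Y U V ≡ W U * W V * fromℕ (if isSub (U ∪ V) Y ∧ (∣ Y ∣ ≡ᵇ l) then 1 else 0)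
      term≡ U V Y rewrite isSub-∪ U V Y with isSub U Y | isSub V Y | ∣ Y ∣ ≡ᵇ l
      ... | true  | true  | true  = sym (trans (cong (W U * W V *_) (+-identityʳ 1#)) (*-identityʳ _))
      ... | true  | true  | false = sym (zeroʳ _)
      ... | true  | false | true  = trans (zeroʳ (W U)) (sym (zeroʳ _))
      ... | true  | false | false = sym (zeroʳ _)
      ... | false | _     | true  = trans (zeroˡ _) (sym (zeroʳ _))
      ... | false | _     | false = sym (zeroʳ _)

      count-supersets : ∀ U V → sumR (map (λ Y → term Y U V) S) ≡ W U * W V * fromℕ (supersetCount l (U ∪ V))
      count-supersets U V = begin-equality
        sumR (map (λ Y → term Y U V) S)                  ≡⟨ cong sumR (map-cong (term≡ U V) S) ⟩
        sumR (map (λ Y → W U * W V * fromℕ (ind Y)) S)    ≡⟨ *-distribˡ-sumR (W U * W V) (fromℕ ∘ ind) S ⟨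
        W U * W V * sumR (map (fromℕ ∘ ind) S)            ≡⟨ cong (W U * W V *_) (fromℕ-sum ind S) ⟨
        W U * W V * fromℕ (supersetCount l (U ∪ V))       ∎
        where
        ind : Subset n → ℕ
        ind Y = if isSub (U ∪ V) Y ∧ (∣ Y ∣ ≡ᵇ l) then 1 else 0

    pairSum0≤normF² : pairSum n inF w 0 ≤ normF n m inF w * normF n m inF w
    pairSum0≤normF² = begin
      pairSum n inF w 0                                       ≤⟨ sumR-mono S (λ _ → sumR-mono S (λ _ → drop-if _)) ⟩
      sumR (map (λ U → sumR (map (λ V → W U * W V) S)) S)     ≡⟨ sumR-*-sumR W W S S ⟨
      sumR (map W S) * sumR (map W S)                         ≡⟨ cong₂ _*_ normF≡ΣW normF≡ΣW ⟨
      normF n m inF w * normF n m inF w                       ∎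
      where
      drop-if : ∀ {U V} b → (if b then W U * W V else 0#) ≤ W U * W V
      drop-if true = ≤-refl
      drop-if {U} {V} false = *-nonneg (0≤W U) (0≤W V)

  module IntersectionProfile (m p d : ℕ) (inF : Subset (m ℕ.+ m ℕ.+ p ℕ.+ d) → Bool) (w : Subset (m ℕ.+ m ℕ.+ p ℕ.+ d) → R)
    (∣U∣≡m : ∀ U → inF U ≡ true → ∣ U ∣ ≡ m) (0≤w : ∀ U → inF U ≡ true → 0# ≤ w U) where
    open Family m inF w ∣U∣≡m 0≤w

    n l : ℕ
    n = m ℕ.+ m ℕ.+ p ℕ.+ d
    l = m ℕ.+ m ℕ.+ p

    Js : List ℕ
    Js = upTo (suc m)

    N : ℕ → R
    N j = fromℕ ((p ℕ.+ j ℕ.+ d) C (p ℕ.+ j))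

    private
      if-* : ∀ b {x y} → (if b then x else 0#) * y ≡ x * (if b then y else 0#)
      if-* true = refl
      if-* false {x} {y} = trans (zeroˡ y) (sym (zeroʳ x))

      annihilate : ∀ {a} x y → a ≡ 0# → a * x ≡ a * y
      annihilate x y refl = trans (zeroˡ x) (sym (zeroˡ y))

    pair≡Σ : ∀ U V → W U * W V * fromℕ (supersetCount l (U ∪ V))
                     ≡ sumR (map (λ j → (if ∣ U ∩ V ∣ ≡ᵇ j then W U * W V else 0#) * N j) Js)
    pair≡Σ U V = begin-equality
      W U * W V * fromℕ (supersetCount l (U ∪ V))                   ≡⟨ on-support ⟩
      W U * W V * sumR (map (λ j → if k ≡ᵇ j then N j else 0#) Js)   ≡⟨ *-distribˡ-sumR (W U * W V) _ Js ⟩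
      sumR (map (λ j → W U * W V * (if k ≡ᵇ j then N j else 0#)) Js) ≡⟨ cong sumR (map-cong (λ j → if-* (k ≡ᵇ j)) Js) ⟨
      sumR (map (λ j → (if k ≡ᵇ j then W U * W V else 0#) * N j) Js) ∎
      where
      k : ℕ
      k = ∣ U ∩ V ∣
      on-support : W U * W V * fromℕ (supersetCount l (U ∪ V)) ≡ W U * W V * sumR (map (λ j → if k ≡ᵇ j then N j else 0#) Js)
      on-support with inF U in U∈F | inF V in V∈F
      ... | false | _ = annihilate _ _ (zeroˡ _)
      ... | true | false = annihilate _ _ (zeroʳ (w U))
      ... | true | true = cong (w U * w V *_) (begin-equality
        fromℕ (supersetCount l (U ∪ V))  ≡⟨ cong fromℕ (supersetCount-∪ U V (∣U∣≡m U U∈F) (∣U∣≡m V V∈F)) ⟩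
        N k                              ≡⟨ sumR-δ k N (ℕ.s≤s (subst (k ℕ.≤_) (∣U∣≡m U U∈F) (∣p∩q∣≤∣p∣ U V))) ⟨
        sumR (map (λ j → if k ≡ᵇ j then N j else 0#) Js) ∎)

    normD≡Σj : normD n m l inF w ≡ sumR (map (λ j → pairSum n inF w j * N j) Js)
    normD≡Σj = begin-equality
      normD n m l inF w
        ≡⟨ normD≡ΣΣ l ⟩
      sumR (map (λ U → sumR (map (λ V → W U * W V * fromℕ (supersetCount l (U ∪ V))) S)) S)
        ≡⟨ cong sumR (map-cong (λ U → cong sumR (map-cong (pair≡Σ U) S)) S) ⟩
      sumR (map (λ U → sumR (map (λ V → sumR (map (term U V) Js)) S)) S)
        ≡⟨ cong sumR (map-cong (λ U → sumR-swap (term U) S Js) S) ⟩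
      sumR (map (λ U → sumR (map (λ j → sumR (map (λ V → term U V j) S)) Js)) S)
        ≡⟨ sumR-swap (λ U j → sumR (map (λ V → term U V j) S)) S Js ⟩
      sumR (map (λ j → sumR (map (λ U → sumR (map (λ V → term U V j) S)) S)) Js)
        ≡⟨ cong sumR (map-cong pull-out-N Js) ⟨
      sumR (map (λ j → pairSum n inF w j * N j) Js) ∎
      where
      term : Subset n → Subset n → ℕ → R
      term U V j = (if ∣ U ∩ V ∣ ≡ᵇ j then W U * W V else 0#) * N j
      pull-out-N : ∀ j → pairSum n inF w j * N j ≡ sumR (map (λ U → sumR (map (λ V → term U V j) S)) S)
      pull-out-N j = trans (*-distribʳ-sumR (N j) _ S) (cong sumR (map-cong (λ U → *-distribʳ-sumR (N j) _ S) S))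

    module Estimate (γ : R) (1≤m : 1 ℕ.≤ m) (2m≤p : m ℕ.+ m ℕ.≤ p) (1<2γ : 1# < fromℕ 2 * γ)
      (Γ : Gamma n m inF w (fromℕ 14 * γ * fromℕ m * fromℕ n * (fromℕ l ⁻¹))) where

      open *-Solver using (solve; _⊕_; _⊜_)

      F² r b M Nn L c Cnl Clm N₀ : R
      F² = normF n m inF w * normF n m inF w
      r = (fromℕ 2 * γ) ⁻¹
      b = fromℕ 14 * γ * M * Nn * (L ⁻¹)
      M = fromℕ m
      Nn = fromℕ n
      L = fromℕ l
      c = fromℕ (n C m)
      Cnl = fromℕ (n C l)
      Clm = fromℕ (l C m)
      N₀ = fromℕ ((p ℕ.+ d) C p)

      0<F² : 0# < F²
      0<F² = *-pos (proj₁ (proj₂ Γ)) (proj₁ (proj₂ Γ))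

      0<b : 0# < b
      0<b = <-trans 0<1 (proj₁ Γ)

      0<N₀ : 0# < N₀
      0<N₀ = 0<fromℕ (k≤n⇒0<nCk (ℕ.m≤m+n p d))

      0<c : 0# < c
      0<c = 0<fromℕ (k≤n⇒0<nCk (ℕ.≤-trans (ℕ.m≤m+n m m) (ℕ.≤-trans (ℕ.m≤m+n (m ℕ.+ m) p) (ℕ.m≤m+n l d))))

      0<L : 0# < L
      0<L = 0<fromℕ (ℕ.≤-trans 1≤m (ℕ.≤-trans (ℕ.m≤m+n m m) (ℕ.m≤m+n (m ℕ.+ m) p)))

      0<2γ : 0# < fromℕ 2 * γ
      0<2γ = <-trans 0<1 1<2γ

      0<r : 0# < r
      0<r = 0<x⇒0<x⁻¹ 0<2γ

      r<1 : r < 1#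
      r<1 = *-cancelʳ-< 0<2γ (subst₂ _<_ (sym (x⁻¹*x≡1 0<2γ)) (sym (*-identityˡ (fromℕ 2 * γ))) 1<2γ)

      private
        fromℕ-a*[b*b] : ∀ a b → fromℕ (a ℕ.* (b ℕ.* b)) ≡ fromℕ a * (fromℕ b * fromℕ b)
        fromℕ-a*[b*b] a b = trans (fromℕ-* a (b ℕ.* b)) (cong (fromℕ a *_) (fromℕ-* b b))

        fromℕ-a*[b*c^j] : ∀ a b c j → fromℕ (a ℕ.* (b ℕ.* c ℕ.^ j)) ≡ fromℕ a * (fromℕ b * fromℕ c ^ j)
        fromℕ-a*[b*c^j] a b c j = trans (fromℕ-* a _) (cong (fromℕ a *_) (trans (fromℕ-* b _) (cong (fromℕ b *_) (fromℕ-^ c j))))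

      N₀≤nCl*[lCm]²/[nCm]² : N₀ ≤ Cnl * (Clm * Clm) * (c * c) ⁻¹
      N₀≤nCl*[lCm]²/[nCm]² = x*z≤y⇒x≤y*z⁻¹ (*-pos 0<c 0<c) (begin
        N₀ * (c * c)
          ≡⟨ fromℕ-a*[b*b] ((p ℕ.+ d) C p) (n C m) ⟨
        fromℕ (((p ℕ.+ d) C p) ℕ.* ((n C m) ℕ.* (n C m)))
          ≤⟨ fromℕ-mono-≤ ([p+d]Cp*[nCm]²≤nCl*[lCm]² m p d) ⟩
        fromℕ ((n C l) ℕ.* ((l C m) ℕ.* (l C m)))
          ≡⟨ fromℕ-a*[b*b] (n C l) (l C m) ⟩
        Cnl * (Clm * Clm) ∎)

      rbL≡7mn : r * b * L ≡ fromℕ 7 * (M * Nn)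
      rbL≡7mn = begin-equality
        r * b * L
          ≡⟨ cong (λ x → r * (x * γ * M * Nn * L ⁻¹) * L) (fromℕ-* 7 2) ⟩
        r * (fromℕ 7 * fromℕ 2 * γ * M * Nn * L ⁻¹) * L
          ≡⟨ solve 8 (λ r s t g m n i l → ((r ⊕ (((((s ⊕ t) ⊕ g) ⊕ m) ⊕ n) ⊕ i)) ⊕ l) ⊜ (((s ⊕ (m ⊕ n)) ⊕ (r ⊕ (t ⊕ g))) ⊕ (i ⊕ l))) refl r (fromℕ 7) (fromℕ 2) γ M Nn (L ⁻¹) L ⟩
        fromℕ 7 * (M * Nn) * (r * (fromℕ 2 * γ)) * (L ⁻¹ * L)
          ≡⟨ cong₂ (λ x y → fromℕ 7 * (M * Nn) * x * y) (x⁻¹*x≡1 0<2γ) (x⁻¹*x≡1 0<L) ⟩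
        fromℕ 7 * (M * Nn) * 1# * 1#
          ≡⟨ trans (*-identityʳ _) (*-identityʳ _) ⟩
        fromℕ 7 * (M * Nn) ∎

      2nm≤rbL : fromℕ 2 * Nn * M ≤ r * b * L
      2nm≤rbL = begin
        fromℕ 2 * Nn * M
          ≡⟨ solve 3 (λ t n m → ((t ⊕ n) ⊕ m) ⊜ (t ⊕ (m ⊕ n))) refl (fromℕ 2) Nn M ⟩
        fromℕ 2 * (M * Nn)
          ≤⟨ *-monoʳ-≤ (*-nonneg (0≤fromℕ m) (0≤fromℕ n)) (fromℕ-mono-≤ {2} {7} (ℕ.s≤s (ℕ.s≤s ℕ.z≤n))) ⟩
        fromℕ 7 * (M * Nn)
          ≡⟨ rbL≡7mn ⟨
        r * b * L ∎

      l≤2[1+p] : l ℕ.≤ 2 ℕ.* suc p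
      l≤2[1+p] = ℕ.≤-trans (ℕ.+-monoˡ-≤ p 2m≤p) (ℕ.≤-trans (ℕ.m≤m+n (p ℕ.+ p) 2) (ℕ.≤-reflexive (p+p+2≡2[1+p] p)))
        where p+p+2≡2[1+p] : ∀ p → p ℕ.+ p ℕ.+ 2 ≡ 2 ℕ.* suc p
              p+p+2≡2[1+p] = solve-∀

      mCj*Nj≤N₀*[rb]^j : ∀ j → fromℕ (m C j) * N j ≤ N₀ * (r * b) ^ j
      mCj*Nj≤N₀*[rb]^j j = *-cancelʳ-≤ (0<x⇒0<x^j j 0<L) (begin
        fromℕ (m C j) * N j * L ^ j
          ≡⟨ *-assoc (fromℕ (m C j)) (N j) (L ^ j) ⟩
        fromℕ (m C j) * (N j * L ^ j)
          ≡⟨ fromℕ-a*[b*c^j] (m C j) ((p ℕ.+ j ℕ.+ d) C (p ℕ.+ j)) l j ⟨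
        fromℕ ((m C j) ℕ.* (((p ℕ.+ j ℕ.+ d) C (p ℕ.+ j)) ℕ.* l ℕ.^ j))
          ≤⟨ fromℕ-mono-≤ (ℕ.*-mono-≤ (nCk≤n^k m j) ([a+j+d]C[a+j]*l^j≤[a+d]Ca*[2[l+d]]^j p d l j l≤2[1+p])) ⟩
        fromℕ (m ℕ.^ j ℕ.* (((p ℕ.+ d) C p) ℕ.* (2 ℕ.* n) ℕ.^ j))
          ≡⟨ fromℕ-a*[b*c^j] (m ℕ.^ j) ((p ℕ.+ d) C p) (2 ℕ.* n) j ⟩
        fromℕ (m ℕ.^ j) * (N₀ * fromℕ (2 ℕ.* n) ^ j)
          ≡⟨ cong₂ (λ x y → x * (N₀ * y ^ j)) (fromℕ-^ m j) (fromℕ-* 2 n) ⟩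
        M ^ j * (N₀ * (fromℕ 2 * Nn) ^ j)
          ≡⟨ solve 3 (λ x y z → (x ⊕ (y ⊕ z)) ⊜ (y ⊕ (z ⊕ x))) refl (M ^ j) N₀ ((fromℕ 2 * Nn) ^ j) ⟩
        N₀ * ((fromℕ 2 * Nn) ^ j * M ^ j)
          ≡⟨ cong (N₀ *_) (^-distribʳ-* (fromℕ 2 * Nn) M j) ⟨
        N₀ * (fromℕ 2 * Nn * M) ^ j
          ≤⟨ *-monoˡ-≤ (inj₁ 0<N₀) (^-monoˡ-≤ j 0≤2nm 2nm≤rbL) ⟩
        N₀ * (r * b * L) ^ j
          ≡⟨ cong (N₀ *_) (^-distribʳ-* (r * b) L j) ⟩
        N₀ * ((r * b) ^ j * L ^ j)
          ≡⟨ *-assoc N₀ ((r * b) ^ j) (L ^ j) ⟨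
        N₀ * (r * b) ^ j * L ^ j ∎)
        where
        0≤2nm : 0# ≤ fromℕ 2 * Nn * M
        0≤2nm = *-nonneg (*-nonneg (0≤fromℕ 2) (0≤fromℕ n)) (0≤fromℕ m)

      pairSum*N≤F²*N₀*r^j : ∀ {j} → j ∈ Js → pairSum n inF w j * N j ≤ F² * N₀ * r ^ j
      pairSum*N≤F²*N₀*r^j {zero} _ = begin
        pairSum n inF w 0 * N 0
          ≡⟨ cong (λ a → pairSum n inF w 0 * fromℕ ((a ℕ.+ d) C a)) (ℕ.+-identityʳ p) ⟩
        pairSum n inF w 0 * N₀
          ≤⟨ *-monoʳ-≤ (inj₁ 0<N₀) pairSum0≤normF² ⟩
        F² * N₀
          ≡⟨ *-identityʳ (F² * N₀) ⟨
        F² * N₀ * 1# ∎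
      pairSum*N≤F²*N₀*r^j {j@(suc _)} j∈Js = begin
        pairSum n inF w j * N j
          ≤⟨ *-monoʳ-≤ (0≤fromℕ ((p ℕ.+ j ℕ.+ d) C (p ℕ.+ j))) (proj₂ (proj₂ Γ) j (ℕ.s≤s ℕ.z≤n) (ℕ.≤-pred (∈-upTo⁻ j∈Js))) ⟩
        F² * fromℕ (m C j) * (b ^ j) ⁻¹ * N j
          ≡⟨ solve 4 (λ a c i x → (((a ⊕ c) ⊕ i) ⊕ x) ⊜ ((a ⊕ (c ⊕ x)) ⊕ i)) refl F² (fromℕ (m C j)) ((b ^ j) ⁻¹) (N j) ⟩
        F² * (fromℕ (m C j) * N j) * (b ^ j) ⁻¹
          ≤⟨ *-monoʳ-≤ (inj₁ (0<x⇒0<x⁻¹ 0<bʲ)) (*-monoˡ-≤ (inj₁ 0<F²) (mCj*Nj≤N₀*[rb]^j j)) ⟩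
        F² * (N₀ * (r * b) ^ j) * (b ^ j) ⁻¹
          ≡⟨ cong (λ x → F² * (N₀ * x) * (b ^ j) ⁻¹) (^-distribʳ-* r b j) ⟩
        F² * (N₀ * (r ^ j * b ^ j)) * (b ^ j) ⁻¹
          ≡⟨ solve 5 (λ a x s t i → ((a ⊕ (x ⊕ (s ⊕ t))) ⊕ i) ⊜ (((a ⊕ x) ⊕ s) ⊕ (t ⊕ i))) refl F² N₀ (r ^ j) (b ^ j) ((b ^ j) ⁻¹) ⟩
        F² * N₀ * r ^ j * (b ^ j * (b ^ j) ⁻¹)
          ≡⟨ cong (F² * N₀ * r ^ j *_) (x*x⁻¹≡1 0<bʲ) ⟩
        F² * N₀ * r ^ j * 1#
          ≡⟨ *-identityʳ _ ⟩
        F² * N₀ * r ^ j ∎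
        where
        0<bʲ : 0# < b ^ j
        0<bʲ = 0<x⇒0<x^j j 0<b

      normD< : normD n m l inF w < F² * (c * c) ⁻¹ * (1# - r) ⁻¹ * Cnl * (Clm * Clm)
      normD< = begin-strict
        normD n m l inF w
          ≡⟨ normD≡Σj ⟩
        sumR (map (λ j → pairSum n inF w j * N j) Js)
          ≤⟨ sumR-mono Js pairSum*N≤F²*N₀*r^j ⟩
        sumR (map (λ j → F² * N₀ * r ^ j) Js)
          ≡⟨ *-distribˡ-sumR (F² * N₀) (r ^_) Js ⟨
        F² * N₀ * sumR (map (r ^_) Js)
          <⟨ *-monoˡ-< (*-pos 0<F² 0<N₀) (geometric-sum< (suc m) 0<r r<1) ⟩
        F² * N₀ * (1# - r) ⁻¹
          ≤⟨ *-monoʳ-≤ (inj₁ (0<x⇒0<x⁻¹ (x<y⇒0<y-x r<1))) (*-monoˡ-≤ (inj₁ 0<F²) N₀≤nCl*[lCm]²/[nCm]²) ⟩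
        F² * (Cnl * (Clm * Clm) * (c * c) ⁻¹) * (1# - r) ⁻¹
          ≡⟨ solve 5 (λ a x y i j → ((a ⊕ ((x ⊕ y) ⊕ i)) ⊕ j) ⊜ ((((a ⊕ i) ⊕ j) ⊕ x) ⊕ y)) refl F² Cnl (Clm * Clm) ((c * c) ⁻¹) ((1# - r) ⁻¹) ⟩
        F² * (c * c) ⁻¹ * (1# - r) ⁻¹ * Cnl * (Clm * Clm) ∎

  -- Writing l = 2m + p and n = l + d keeps all the binomial arithmetic free of truncated subtraction.
  normD-bound : ∀ (n m l p d : ℕ) (γ : R) (inF : Subset n → Bool) (w : Subset n → R) →
    m ℕ.+ m ℕ.+ p ≡ l → l ℕ.+ d ≡ n → 1 ℕ.≤ m → m ℕ.+ m ℕ.≤ p → 1# < fromℕ 2 * γ →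
    (∀ U → inF U ≡ true → ∣ U ∣ ≡ m) → (∀ U → inF U ≡ true → 0# ≤ w U) →
    Gamma n m inF w (fromℕ 14 * γ * fromℕ m * fromℕ n * (fromℕ l ⁻¹)) →
    normD n m l inF w <
      ((normF n m inF w * normF n m inF w) * ((fromℕ (n C m) * fromℕ (n C m)) ⁻¹))
      * ((1# - ((fromℕ 2 * γ) ⁻¹)) ⁻¹)
      * fromℕ (n C l) * (fromℕ (l C m) * fromℕ (l C m))
  normD-bound _ m _ p d γ inF w refl refl 1≤m 2m≤p 1<2γ ∣U∣≡m 0≤w Γ =
    IntersectionProfile.Estimate.normD< m p d inF w ∣U∣≡m 0≤w γ 1≤m 2m≤p 1<2γ Γ

lemma2p4 : (K : RealField) → let open RealField K in let open Over K in
    Σ R λ γ₀ → (0# < γ₀) ×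
      (∀ (n m l : ℕ) (γ : R) (inF : Subset n → Bool) (w : Subset n → R) →
        1 ℕ.≤ m → m ℕ.≤ n → m ℕ.< l → l ℕ.≤ n →
        γ₀ ≤ γ → γ ≤ fromℕ l * (fromℕ (m ℕ.* m) ⁻¹) → γ ≤ fromℕ (n C l) →
        (∀ U → inF U ≡ true → ∣ U ∣ ≡ m) →
        (∀ U → inF U ≡ true → 0# ≤ w U) →
        Gamma n m inF w (fromℕ 14 * γ * fromℕ m * fromℕ n * (fromℕ l ⁻¹)) →
        normD n m l inF w <
          ((normF n m inF w * normF n m inF w) * ((fromℕ (n C m) * fromℕ (n C m)) ⁻¹))
          * ((1# - ((fromℕ 2 * γ) ⁻¹)) ⁻¹)
          * fromℕ (n C l) * (fromℕ (l C m) * fromℕ (l C m)))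
lemma2p4 K = fromℕ 4 , 0<fromℕ {4} (ℕ.s≤s ℕ.z≤n) ,
  λ n m l γ inF w 1≤m _ _ l≤n 4≤γ γ≤l/m² _ → let 2m+2m≤l = 4m≤l 1≤m 4≤γ γ≤l/m² in
    WeightedFamilies.normD-bound K n m l (l ℕ.∸ (m ℕ.+ m)) (n ℕ.∸ l) γ inF w
      (ℕ.m+[n∸m]≡n (ℕ.≤-trans (ℕ.m≤m+n (m ℕ.+ m) (m ℕ.+ m)) 2m+2m≤l)) (ℕ.m+[n∸m]≡n l≤n)
      1≤m (ℕ.m+n≤o⇒m≤o∸n (m ℕ.+ m) 2m+2m≤l) (1<2γ 4≤γ)
  where
  open RealField K
  open OrderedFieldProperties K
  open ≤-Reasoning
  import Data.Nat.Properties as ℕ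
  open import Data.Nat.Tactic.RingSolver using (solve-∀)
  open import Relation.Binary.PropositionalEquality

  4m≤l : ∀ {m l γ} → 1 ℕ.≤ m → fromℕ 4 ≤ γ → γ ≤ fromℕ l * (fromℕ (m ℕ.* m) ⁻¹) → m ℕ.+ m ℕ.+ (m ℕ.+ m) ℕ.≤ l
  4m≤l {m} {l} {γ} 1≤m 4≤γ γ≤l/m² = ℕ.≤-trans 4m≤4m² (fromℕ-cancel-≤ (begin
    fromℕ (4 ℕ.* (m ℕ.* m))           ≡⟨ fromℕ-* 4 (m ℕ.* m) ⟩
    fromℕ 4 * m²                      ≤⟨ *-monoʳ-≤ (0≤fromℕ (m ℕ.* m)) (≤-trans 4≤γ γ≤l/m²) ⟩
    fromℕ l * m² ⁻¹ * m²              ≡⟨ *-assoc (fromℕ l) (m² ⁻¹) m² ⟩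
    fromℕ l * (m² ⁻¹ * m²)            ≡⟨ cong (fromℕ l *_) (x⁻¹*x≡1 (0<fromℕ (ℕ.*-mono-≤ 1≤m 1≤m))) ⟩
    fromℕ l * 1#                      ≡⟨ *-identityʳ (fromℕ l) ⟩
    fromℕ l                           ∎))
    where
    m² : R
    m² = fromℕ (m ℕ.* m)
    4m≤4m² : m ℕ.+ m ℕ.+ (m ℕ.+ m) ℕ.≤ 4 ℕ.* (m ℕ.* m)
    4m≤4m² = ℕ.≤-trans (ℕ.≤-reflexive (4m≡4*m m)) (ℕ.*-monoʳ-≤ 4 (ℕ.m≤m*n m m {{ℕ.>-nonZero 1≤m}}))
      where 4m≡4*m : ∀ m → m ℕ.+ m ℕ.+ (m ℕ.+ m) ≡ 4 ℕ.* m
            4m≡4*m = solve-∀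

  1<2γ : ∀ {γ} → fromℕ 4 ≤ γ → 1# < fromℕ 2 * γ
  1<2γ {γ} 4≤γ = begin-strict
    1#                  ≡⟨ +-identityʳ 1# ⟨
    fromℕ 1             <⟨ fromℕ-mono-< {1} {8} (ℕ.s≤s (ℕ.s≤s ℕ.z≤n)) ⟩
    fromℕ (2 ℕ.* 4)     ≡⟨ fromℕ-* 2 4 ⟩
    fromℕ 2 * fromℕ 4   ≤⟨ *-monoˡ-≤ (0≤fromℕ 2) 4≤γ ⟩
    fromℕ 2 * γ         ∎
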